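{- Let $n$ and $N$ be integers satisfying $N\geq n\geq 2$. Then \[ \sum_{\substack{(a_1,\dots,a_n)\in\mathbb{Z}_{>0}^n\\ a_1+\cdots+a_n=N}}\frac{C(a_1,\dots,a_n)}{a_1\cdots a_n}=O\left(\frac{1}{N^2}\right), \] where for non-negative integers $a_1,\dots,a_n$ the connector is \[ C(a_1,\dots,a_n)=\frac{a_1!\,a_2!\cdots a_n!}{(a_1+a_2+\cdots+a_n)!}, \] i.e. the inverse of the multinomial coefficient.
   Context: The connector $C(a_1,\dots,a_n)$ is the inverse of a multinomial coefficient. The big-$O$ is as $N\to\infty$. -}

module Defs where

open import Data.Nat as ℕ using (ℕ; zero; suc; _≤ᵇ_; _!)
open import Data.Bool using (Bool; true; false; _∧_)
open import Data.List using (List; []; _∷_; [_]; map; concatMap; upTo; filter; foldr)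
open import Data.Integer using (+_)
open import Data.Rational using (ℚ; 0ℚ; _/_; _+_; _*_)
open import Relation.Binary.PropositionalEquality using (_≡_)
open import Relation.Nullary.Decidable using (Dec; yes; no)
open import Data.Bool.Properties using (T?)
open import Data.Bool using (T)

toℚ : ℕ → ℚ
toℚ m = (+ m) / 1

-- reciprocal of a natural number, with the (unused) convention 1/0 := 0
inv : ℕ → ℚ
inv zero    = 0ℚ
inv (suc k) = (+ 1) / suc k

tuples : ℕ → ℕ → List (List ℕ)
tuples zero    N = [ [] ]
tuples (suc n) N = concatMap (λ a → map (a ∷_) (tuples n N)) (upTo (suc N))

sumℕ : List ℕ → ℕ
sumℕ = foldr ℕ._+_ 0

prodℕ : List ℕ → ℕ
prodℕ = foldr ℕ._*_ 1

allPos : List ℕ → Bool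
allPos []       = true
allPos (a ∷ as) = (1 ≤ᵇ a) ∧ allPos as

isComp : ℕ → List ℕ → Bool
isComp N as = allPos as ∧ (sumℕ as ℕ.≡ᵇ N)

compositions : ℕ → ℕ → List (List ℕ)
compositions n N = filter (λ as → T? (isComp N as)) (tuples n N)

connector : List ℕ → ℚ
connector as = toℚ (prodℕ (map _! as)) * inv (sumℕ as !)

term : List ℕ → ℚ
term as = connector as * inv (prodℕ as)

sumℚ : List ℚ → ℚ
sumℚ = foldr _+_ 0ℚ

S : ℕ → ℕ → ℚ
S n N = sumℚ (map term (compositions n N))

-- Since a! = a · (a − 1)!, the summand for a composition (a₁,…,aₙ) of N is (a₁−1)!⋯(aₙ−1)!/N!,
-- so S(n,N) = T(n,N)/N! where T(n,M) is the total weight ∏(aᵢ−1)! of the compositions of M into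
-- n parts. Splitting off the first part a₁ = k + 1 gives T(n+1,M) = ∑_{k<M} k!·T(n,M−k−1), and
-- together with ∑_{k≤s} k!(s−k)! ≤ 3·s! this yields T(n,N) ≤ 3ⁿ(N−n)! ≤ 3ⁿ(N−2)!. Finally
-- N²(N−2)! ≤ 2·N!, hence S(n,N) ≤ 2·3ⁿ/N².
module Submission where

open import Defs

module Compositions where

  open import Data.Nat
  open import Data.Nat.Properties
  open import Data.Nat.Combinatorics using (k![n∸k]!∣n!)
  open import Data.Nat.Divisibility using (∣⇒≤)
  open import Data.Nat.ListAction.Properties using (sum-++)
  open import Data.Nat.Tactic.RingSolver using (solve-∀)
  open import Data.Bool using (true; false; if_then_else_; T; _∧_)
  open import Data.Bool.Properties using (∧-zeroʳ)
  open import Data.List using (List; []; _∷_; _++_; map; concatMap; applyUpTo; upTo)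
  open import Data.List.Properties using (map-++; map-∘; map-cong)
  open import Data.Product using (_,_)
  open import Function using (_∘_; id)
  open import Relation.Binary.PropositionalEquality
  open import Relation.Nullary.Decidable using (dec-false)

  ∑< : ℕ → (ℕ → ℕ) → ℕ
  ∑< zero    f = 0
  ∑< (suc n) f = f 0 + ∑< n (f ∘ suc)

  syntax ∑< n (λ k → e) = ∑[ k < n ] e

  ∑-last : ∀ n f → ∑< (suc n) f ≡ ∑< n f + f n
  ∑-last zero    f = +-comm (f 0) 0
  ∑-last (suc n) f = trans (cong (f 0 +_) (∑-last n (f ∘ suc))) (sym (+-assoc (f 0) _ _))

  ∑-cong : ∀ n {f g} → (∀ k → k < n → f k ≡ g k) → ∑< n f ≡ ∑< n g
  ∑-cong zero    eq = refl
  ∑-cong (suc n) eq = cong₂ _+_ (eq 0 z<s) (∑-cong n λ k k<n → eq (suc k) (s<s k<n))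

  ∑-mono-≤ : ∀ n {f g} → (∀ k → k < n → f k ≤ g k) → ∑< n f ≤ ∑< n g
  ∑-mono-≤ zero    le = z≤n
  ∑-mono-≤ (suc n) le = +-mono-≤ (le 0 z<s) (∑-mono-≤ n λ k k<n → le (suc k) (s<s k<n))

  ∑-≤-* : ∀ n {f c} → (∀ k → k < n → f k ≤ c) → ∑< n f ≤ n * c
  ∑-≤-* zero    le = z≤n
  ∑-≤-* (suc n) le = +-mono-≤ (le 0 z<s) (∑-≤-* n λ k k<n → le (suc k) (s<s k<n))

  ∑-zero : ∀ n {f} → (∀ k → k < n → f k ≡ 0) → ∑< n f ≡ 0
  ∑-zero zero    eq = refl
  ∑-zero (suc n) eq = cong₂ _+_ (eq 0 z<s) (∑-zero n λ k k<n → eq (suc k) (s<s k<n))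

  ∑-truncate : ∀ {m n f} → m ≤ n → (∀ k → m ≤ k → k < n → f k ≡ 0) → ∑< n f ≡ ∑< m f
  ∑-truncate {zero}  {n}     z≤n       vanish = ∑-zero n (λ k → vanish k z≤n)
  ∑-truncate {suc m} {suc n} {f} (s≤s m≤n) vanish =
    cong (f 0 +_) (∑-truncate m≤n λ k m≤k k<n → vanish (suc k) (s≤s m≤k) (s<s k<n))

  ∑-*ˡ : ∀ c n f → ∑[ k < n ] (c * f k) ≡ c * ∑< n f
  ∑-*ˡ c zero    f = sym (*-zeroʳ c)
  ∑-*ˡ c (suc n) f =
    trans (cong (c * f 0 +_) (∑-*ˡ c n (f ∘ suc))) (sym (*-distribˡ-+ c (f 0) _))

  sum-map-applyUpTo : ∀ (g f : ℕ → ℕ) n → sumℕ (map g (applyUpTo f n)) ≡ ∑< n (g ∘ f)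
  sum-map-applyUpTo g f zero    = refl
  sum-map-applyUpTo g f (suc n) = cong (g (f 0) +_) (sum-map-applyUpTo g (f ∘ suc) n)

  sum-map-concatMap : ∀ {A B : Set} (g : B → ℕ) (h : A → List B) xs →
    sumℕ (map g (concatMap h xs)) ≡ sumℕ (map (sumℕ ∘ map g ∘ h) xs)
  sum-map-concatMap g h []       = refl
  sum-map-concatMap g h (x ∷ xs) = begin
    sumℕ (map g (h x ++ concatMap h xs))                ≡⟨ cong sumℕ (map-++ g (h x) _) ⟩
    sumℕ (map g (h x) ++ map g (concatMap h xs))        ≡⟨ sum-++ (map g (h x)) _ ⟩
    sumℕ (map g (h x)) + sumℕ (map g (concatMap h xs))  ≡⟨ cong (_ +_) (sum-map-concatMap g h xs) ⟩
    sumℕ (map g (h x)) + sumℕ (map (sumℕ ∘ map g ∘ h) xs) ∎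
    where open ≡-Reasoning

  sum-map-*ˡ : ∀ {A : Set} c (f : A → ℕ) xs → sumℕ (map (λ x → c * f x) xs) ≡ c * sumℕ (map f xs)
  sum-map-*ˡ c f []       = sym (*-zeroʳ c)
  sum-map-*ˡ c f (x ∷ xs) =
    trans (cong (c * f x +_) (sum-map-*ˡ c f xs)) (sym (*-distribˡ-+ c (f x) _))

  sum-map-zero : ∀ {A : Set} {f : A → ℕ} → (∀ x → f x ≡ 0) → ∀ xs → sumℕ (map f xs) ≡ 0
  sum-map-zero eq []       = refl
  sum-map-zero eq (x ∷ xs) = cong₂ _+_ (eq x) (sum-map-zero eq xs)

  sum-map-tuples-suc : ∀ (g : List ℕ → ℕ) n N →
    sumℕ (map g (tuples (suc n) N)) ≡ ∑[ a < suc N ] sumℕ (map (g ∘ (a ∷_)) (tuples n N))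
  sum-map-tuples-suc g n N = begin
    sumℕ (map g (concatMap (λ a → map (a ∷_) (tuples n N)) (upTo (suc N))))
      ≡⟨ sum-map-concatMap g (λ a → map (a ∷_) (tuples n N)) (upTo (suc N)) ⟩
    sumℕ (map (λ a → sumℕ (map g (map (a ∷_) (tuples n N)))) (upTo (suc N)))
      ≡⟨ cong sumℕ (map-cong (λ a → cong sumℕ (sym (map-∘ (tuples n N)))) (upTo (suc N))) ⟩
    sumℕ (map (λ a → sumℕ (map (g ∘ (a ∷_)) (tuples n N))) (upTo (suc N)))
      ≡⟨ sum-map-applyUpTo _ id (suc N) ⟩
    ∑[ a < suc N ] sumℕ (map (g ∘ (a ∷_)) (tuples n N)) ∎
    where open ≡-Reasoning

  [1+m]!*[1+n]!≤[1+m+n]! : ∀ m n → suc m ! * suc n ! ≤ suc (m + n) !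
  [1+m]!*[1+n]!≤[1+m+n]! zero    n = ≤-reflexive (*-identityˡ (suc n !))
  [1+m]!*[1+n]!≤[1+m+n]! (suc m) n = begin
    (2 + m) * suc m ! * suc n !   ≡⟨ *-assoc (2 + m) (suc m !) (suc n !) ⟩
    (2 + m) * (suc m ! * suc n !) ≤⟨ *-monoʳ-≤ (2 + m) ([1+m]!*[1+n]!≤[1+m+n]! m n) ⟩
    (2 + m) * suc (m + n) !       ≤⟨ *-monoˡ-≤ (suc (m + n) !) (s≤s (s≤s (m≤m+n m n))) ⟩
    (2 + m + n) * suc (m + n) !   ∎
    where open ≤-Reasoning

  !-mono-≤ : ∀ {m n} → m ≤ n → m ! ≤ n !
  !-mono-≤ {m} {n} m≤n =
    ≤-trans (m≤m*n (m !) ((n ∸ m) !) {{(n ∸ m) !≢0}}) (∣⇒≤ {{n !≢0}} (k![n∸k]!∣n! m≤n))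

  -- The two outer terms are s!, and each of the s − 1 inner ones is at most (s−1)!.
  ∑k!*[s∸k]!≤3*s! : ∀ s → ∑[ k < suc s ] (k ! * (s ∸ k) !) ≤ 3 * s !
  ∑k!*[s∸k]!≤3*s! zero    = s≤s z≤n
  ∑k!*[s∸k]!≤3*s! (suc t) = begin
    1 * X + ∑< (suc t) inner          ≡⟨ cong (1 * X +_) (∑-last t inner) ⟩
    1 * X + (∑< t inner + inner t)    ≤⟨ +-monoʳ-≤ (1 * X) (+-mono-≤ innerSum (≤-reflexive lastTerm)) ⟩
    1 * X + (X + X * 1)               ≡⟨ x+x+x X ⟩
    3 * X                             ∎
    where
    open ≤-Reasoning
    X = suc t !
    inner : ℕ → ℕ
    inner k = suc k ! * (t ∸ k) !
    x+x+x : ∀ x → 1 * x + (x + x * 1) ≡ 3 * x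
    x+x+x = solve-∀
    lastTerm : inner t ≡ X * 1
    lastTerm = cong (λ u → X * u !) (n∸n≡0 t)
    innerTerm : ∀ k → k < t → inner k ≤ t !
    innerTerm k k<t = begin
      suc k ! * (t ∸ k) !               ≡⟨ cong (λ u → suc k ! * u !) (+-∸-assoc 1 k<t) ⟩
      suc k ! * suc (t ∸ suc k) !       ≤⟨ [1+m]!*[1+n]!≤[1+m+n]! k (t ∸ suc k) ⟩
      suc (k + (t ∸ suc k)) !           ≡⟨ cong _! (m+[n∸m]≡n k<t) ⟩
      t !                               ∎
    innerSum : ∑< t inner ≤ X
    innerSum = ≤-trans (∑-≤-* t innerTerm) (m≤n+m (t * t !) (t !))

  ∏pred! : List ℕ → ℕ
  ∏pred! []       = 1
  ∏pred! (a ∷ as) = pred a ! * ∏pred! as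

  weight : ℕ → List ℕ → ℕ
  weight M as = if isComp M as then ∏pred! as else 0

  +-cancelˡ-≡ᵇ : ∀ k m n → (k + m ≡ᵇ k + n) ≡ (m ≡ᵇ n)
  +-cancelˡ-≡ᵇ zero    m n = refl
  +-cancelˡ-≡ᵇ (suc k) m n = +-cancelˡ-≡ᵇ k m n

  weight-∷ : ∀ k j as → weight (suc k + j) (suc k ∷ as) ≡ k ! * weight j as
  weight-∷ k j as rewrite +-cancelˡ-≡ᵇ (suc k) (sumℕ as) j with allPos as ∧ (sumℕ as ≡ᵇ j)
  ... | true  = refl
  ... | false = sym (*-zeroʳ (k !))

  weight-∷-< : ∀ {M} k as → k < M → weight M (suc k ∷ as) ≡ k ! * weight (M ∸ suc k) as
  weight-∷-< {M} k as k<M =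
    subst (λ m → weight m (suc k ∷ as) ≡ k ! * weight (M ∸ suc k) as)
          (m+[n∸m]≡n k<M) (weight-∷ k (M ∸ suc k) as)

  weight-∷-≥ : ∀ {M} k as → M ≤ k → weight M (suc k ∷ as) ≡ 0
  weight-∷-≥ {M} k as M≤k = trans (cong (λ b → if allPos as ∧ b then P else 0) sum≢M)
                                  (cong (λ b → if b then P else 0) (∧-zeroʳ (allPos as)))
    where
    P = ∏pred! (suc k ∷ as)
    sum≢M : (suc k + sumℕ as ≡ᵇ M) ≡ false
    sum≢M = dec-false (suc k + sumℕ as ≟ M) λ eq →
      <⇒≱ (s≤s (m≤m+n k (sumℕ as))) (subst (_≤ k) (sym eq) M≤k)

  -- The total of ∏pred! over the compositions of M into n parts; k + 1 is the first part.
  totalWeight : ℕ → ℕ → ℕ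
  totalWeight zero    zero    = 1
  totalWeight zero    (suc _) = 0
  totalWeight (suc n) M       = ∑[ k < M ] (k ! * totalWeight n (M ∸ suc k))

  -- Entries of tuples n N are capped at N, which loses nothing as long as M ≤ N.
  sum-weight-tuples : ∀ n {M N} → M ≤ N → sumℕ (map (weight M) (tuples n N)) ≡ totalWeight n M
  sum-weight-tuples zero    {zero}  _   = refl
  sum-weight-tuples zero    {suc M} _   = refl
  sum-weight-tuples (suc n) {M} {N} M≤N = begin
    sumℕ (map (weight M) (tuples (suc n) N))
      ≡⟨ sum-map-tuples-suc (weight M) n N ⟩
    first 0 + ∑[ k < N ] first (suc k)
      ≡⟨ cong (_+ ∑[ k < N ] first (suc k)) (sum-map-zero (λ _ → refl) L) ⟩
    ∑[ k < N ] first (suc k)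
      ≡⟨ ∑-truncate M≤N (λ k M≤k _ → sum-map-zero (λ as → weight-∷-≥ k as M≤k) L) ⟩
    ∑[ k < M ] first (suc k)
      ≡⟨ ∑-cong M firstPart ⟩
    totalWeight (suc n) M ∎
    where
    open ≡-Reasoning
    L = tuples n N
    first : ℕ → ℕ
    first a = sumℕ (map (weight M ∘ (a ∷_)) L)
    firstPart : ∀ k → k < M → first (suc k) ≡ k ! * totalWeight n (M ∸ suc k)
    firstPart k k<M = begin
      first (suc k)
        ≡⟨ cong sumℕ (map-cong (λ as → weight-∷-< k as k<M) L) ⟩
      sumℕ (map (λ as → k ! * weight (M ∸ suc k) as) L)
        ≡⟨ sum-map-*ˡ (k !) (weight (M ∸ suc k)) L ⟩
      k ! * sumℕ (map (weight (M ∸ suc k)) L)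
        ≡⟨ cong (k ! *_) (sum-weight-tuples n (≤-trans (m∸n≤m M (suc k)) M≤N)) ⟩
      k ! * totalWeight n (M ∸ suc k) ∎

  totalWeight-zero : ∀ n {M} → M < n → totalWeight n M ≡ 0
  totalWeight-zero (suc n) {M} (s≤s M≤n) = ∑-zero M λ k k<M →
    trans (cong (k ! *_) (totalWeight-zero n (<-≤-trans (∸-monoʳ-< z<s k<M) M≤n))) (*-zeroʳ (k !))

  [m+n]∸o<m : ∀ m {n o} → n < o → o ≤ m + n → m + n ∸ o < m
  [m+n]∸o<m m {n} {o} n<o o≤m+n = +-cancelʳ-< o (m + n ∸ o) m (begin-strict
    m + n ∸ o + o  ≡⟨ m∸n+n≡m o≤m+n ⟩
    m + n          <⟨ +-monoʳ-< m n<o ⟩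
    m + o          ∎)
    where open ≤-Reasoning

  totalWeight-≤ : ∀ n s → totalWeight n (n + s) ≤ 3 ^ n * s !
  totalWeight-≤ zero    zero    = s≤s z≤n
  totalWeight-≤ zero    (suc s) = z≤n
  totalWeight-≤ (suc n) s = begin
    ∑[ k < suc (n + s) ] (k ! * totalWeight n (n + s ∸ k))
      ≡⟨ ∑-truncate (s≤s (m≤n+m s n)) vanish ⟩
    ∑[ k < suc s ] (k ! * totalWeight n (n + s ∸ k))
      ≤⟨ ∑-mono-≤ (suc s) term≤ ⟩
    ∑[ k < suc s ] (3 ^ n * (k ! * (s ∸ k) !))
      ≡⟨ ∑-*ˡ (3 ^ n) (suc s) (λ k → k ! * (s ∸ k) !) ⟩
    3 ^ n * ∑[ k < suc s ] (k ! * (s ∸ k) !)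
      ≤⟨ *-monoʳ-≤ (3 ^ n) (∑k!*[s∸k]!≤3*s! s) ⟩
    3 ^ n * (3 * s !)
      ≡⟨ x*[3*y]≡3*x*y (3 ^ n) (s !) ⟩
    3 ^ suc n * s ! ∎
    where
    open ≤-Reasoning
    x*[3*y]≡3*x*y : ∀ x y → x * (3 * y) ≡ 3 * x * y
    x*[3*y]≡3*x*y = solve-∀
    x*[y*z]≡y*[x*z] : ∀ x y z → x * (y * z) ≡ y * (x * z)
    x*[y*z]≡y*[x*z] = solve-∀
    vanish : ∀ k → suc s ≤ k → k < suc (n + s) → k ! * totalWeight n (n + s ∸ k) ≡ 0
    vanish k s<k (s≤s k≤n+s) =
      trans (cong (k ! *_) (totalWeight-zero n ([m+n]∸o<m n s<k k≤n+s))) (*-zeroʳ (k !))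
    term≤ : ∀ k → k < suc s → k ! * totalWeight n (n + s ∸ k) ≤ 3 ^ n * (k ! * (s ∸ k) !)
    term≤ k (s≤s k≤s) = begin
      k ! * totalWeight n (n + s ∸ k)     ≡⟨ cong (λ m → k ! * totalWeight n m) (+-∸-assoc n k≤s) ⟩
      k ! * totalWeight n (n + (s ∸ k))   ≤⟨ *-monoʳ-≤ (k !) (totalWeight-≤ n (s ∸ k)) ⟩
      k ! * (3 ^ n * (s ∸ k) !)           ≡⟨ x*[y*z]≡y*[x*z] (k !) (3 ^ n) ((s ∸ k) !) ⟩
      3 ^ n * (k ! * (s ∸ k) !)           ∎

  square*!≤2*! : ∀ {s m} → s ≤ m → (2 + m) * (2 + m) * s ! ≤ 2 * (2 + m) !
  square*!≤2*! {s} {m} s≤m = begin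
    N * N * s !                 ≤⟨ *-monoʳ-≤ (N * N) (!-mono-≤ s≤m) ⟩
    N * N * m !                 ≤⟨ m≤m+n (N * N * m !) (N * m * m !) ⟩
    N * N * m ! + N * m * m !   ≡⟨ identity m (m !) ⟩
    2 * N !                     ∎
    where
    open ≤-Reasoning
    N = 2 + m
    identity : ∀ m x → (2 + m) * (2 + m) * x + (2 + m) * m * x ≡ 2 * ((2 + m) * ((1 + m) * x))
    identity = solve-∀

  totalWeight*square≤ : ∀ {n N} → 2 ≤ n → n ≤ N → totalWeight n N * (N * N) ≤ 2 * 3 ^ n * N !
  totalWeight*square≤ {n@(suc (suc n′))} (s≤s (s≤s _)) n≤N with m≤n⇒∃[o]m+o≡n n≤N
  ... | s , refl = begin
    totalWeight n (n + s) * (N * N)  ≤⟨ *-monoˡ-≤ (N * N) (totalWeight-≤ n s) ⟩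
    3 ^ n * s ! * (N * N)            ≡⟨ rearrange (3 ^ n) (s !) N ⟩
    3 ^ n * (N * N * s !)            ≤⟨ *-monoʳ-≤ (3 ^ n) (square*!≤2*! (m≤n+m s n′)) ⟩
    3 ^ n * (2 * N !)                ≡⟨ x*[2*y]≡2*x*y (3 ^ n) (N !) ⟩
    2 * 3 ^ n * N !                  ∎
    where
    open ≤-Reasoning
    N = n + s
    rearrange : ∀ x y z → x * y * (z * z) ≡ x * (z * z * y)
    rearrange = solve-∀
    x*[2*y]≡2*x*y : ∀ x y → x * (2 * y) ≡ 2 * x * y
    x*[2*y]≡2*x*y = solve-∀

  ∏-nonZero : ∀ as → T (allPos as) → NonZero (prodℕ as)
  ∏-nonZero []           _   = _
  ∏-nonZero (suc k ∷ as) pos = m*n≢0 (suc k) (prodℕ as) {{_}} {{∏-nonZero as pos}}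

  ∏!≡∏*∏pred! : ∀ as → T (allPos as) → prodℕ (map _! as) ≡ prodℕ as * ∏pred! as
  ∏!≡∏*∏pred! []           _   = refl
  ∏!≡∏*∏pred! (suc k ∷ as) pos = begin
    suc k * k ! * prodℕ (map _! as)          ≡⟨ cong (suc k * k ! *_) (∏!≡∏*∏pred! as pos) ⟩
    suc k * k ! * (prodℕ as * ∏pred! as)     ≡⟨ interchange (suc k) (k !) (prodℕ as) (∏pred! as) ⟩
    suc k * prodℕ as * (k ! * ∏pred! as)     ∎
    where
    open ≡-Reasoning
    interchange : ∀ a b c d → a * b * (c * d) ≡ a * c * (b * d)
    interchange = solve-∀

module Rationals where

  open import Data.Nat as ℕ using (ℕ; suc; NonZero; _!)
  import Data.Nat.Properties as ℕₚ
  import Data.Nat.Coprimality as Coprime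
  open Coprime using (1-coprimeTo)
  open import Data.Integer as ℤ using (+_)
  import Data.Integer.Properties as ℤₚ
  open import Data.Rational using (ℚ; mkℚ; 0ℚ; 1ℚ; _+_; _*_; 1/_; _/_; ∣_∣; Positive; *≤*)
    renaming (_≤_ to _≤ℚ_)
  open import Data.Rational.Properties
  open import Data.Bool using (Bool; true; false; if_then_else_; T)
  open import Data.Bool.Properties using (T-∧)
  open import Data.List using ([]; _∷_; map; filterᵇ)
  open import Data.Product using (_,_)
  open import Function using (Equivalence)
  open import Relation.Binary.PropositionalEquality
  open Compositions

  toℚ≡mkℚ : ∀ m → toℚ m ≡ mkℚ (+ m) 0 (Coprime.sym (1-coprimeTo m))
  toℚ≡mkℚ m = normalize-coprime (Coprime.sym (1-coprimeTo m))

  toℚ-+ : ∀ a b → toℚ (a ℕ.+ b) ≡ toℚ a + toℚ b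
  toℚ-+ a b = sym (begin
    toℚ a + toℚ b
      ≡⟨ cong₂ _+_ (toℚ≡mkℚ a) (toℚ≡mkℚ b) ⟩
    ((+ a) ℤ.* (+ 1) ℤ.+ (+ b) ℤ.* (+ 1)) / 1
      ≡⟨ cong (_/ 1) (cong₂ ℤ._+_ (ℤₚ.*-identityʳ (+ a)) (ℤₚ.*-identityʳ (+ b))) ⟩
    ((+ a) ℤ.+ (+ b)) / 1
      ≡⟨ cong (_/ 1) (sym (ℤₚ.pos-+ a b)) ⟩
    toℚ (a ℕ.+ b) ∎)
    where open ≡-Reasoning

  toℚ-* : ∀ a b → toℚ (a ℕ.* b) ≡ toℚ a * toℚ b
  toℚ-* a b = sym (begin
    toℚ a * toℚ b             ≡⟨ cong₂ _*_ (toℚ≡mkℚ a) (toℚ≡mkℚ b) ⟩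
    ((+ a) ℤ.* (+ b)) / 1     ≡⟨ cong (_/ 1) (sym (ℤₚ.pos-* a b)) ⟩
    toℚ (a ℕ.* b)             ∎)
    where open ≡-Reasoning

  toℚ-mono-≤ : ∀ {a b} → a ℕ.≤ b → toℚ a ≤ℚ toℚ b
  toℚ-mono-≤ {a} {b} a≤b rewrite toℚ≡mkℚ a | toℚ≡mkℚ b =
    *≤* (subst₂ ℤ._≤_ (sym (ℤₚ.*-identityʳ (+ a))) (sym (ℤₚ.*-identityʳ (+ b))) (ℤ.+≤+ a≤b))

  inv*toℚ-cancelˡ : ∀ m .{{_ : NonZero m}} q → inv m * (toℚ m * q) ≡ q
  inv*toℚ-cancelˡ (suc k) q = begin
    inv (suc k) * (toℚ (suc k) * q)   ≡⟨ sym (*-assoc (inv (suc k)) _ q) ⟩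
    inv (suc k) * toℚ (suc k) * q     ≡⟨ cong (_* q) (cong₂ _*_ (normalize-coprime (1-coprimeTo (suc k))) (toℚ≡mkℚ (suc k))) ⟩
    1/ p * p * q                       ≡⟨ cong (_* q) (*-inverseˡ p) ⟩
    1ℚ * q                             ≡⟨ *-identityˡ q ⟩
    q                                  ∎
    where
    open ≡-Reasoning
    p = mkℚ (+ suc k) 0 (Coprime.sym (1-coprimeTo (suc k)))

  toℚ*inv-nonNeg : ∀ a b .{{_ : NonZero b}} → 0ℚ ≤ℚ toℚ a * inv b
  toℚ*inv-nonNeg a (suc k) = nonNegative⁻¹ _
    {{nonNeg*nonNeg⇒nonNeg (toℚ a) {{normalize-nonNeg a 1}}
                           (inv (suc k)) {{normalize-nonNeg 1 (suc k)}}}}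

  toℚ*inv-mono-≤ : ∀ a b c d .{{_ : NonZero b}} .{{_ : NonZero d}} →
    a ℕ.* d ℕ.≤ c ℕ.* b → toℚ a * inv b ≤ℚ toℚ c * inv d
  toℚ*inv-mono-≤ a b c d ad≤cb = *-cancelʳ-≤-pos (toℚ (b ℕ.* d)) {{bd-pos}}
    (subst₂ _≤ℚ_ (scale a b d) scale-cb (toℚ-mono-≤ ad≤cb))
    where
    bd-pos : Positive (toℚ (b ℕ.* d))
    bd-pos = normalize-pos (b ℕ.* d) 1 {{_}} {{ℕₚ.m*n≢0 b d}}
    scale : ∀ x y z .{{_ : NonZero y}} → toℚ (x ℕ.* z) ≡ toℚ x * inv y * toℚ (y ℕ.* z)
    scale x y z = begin
      toℚ (x ℕ.* z)                        ≡⟨ toℚ-* x z ⟩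
      toℚ x * toℚ z                        ≡⟨ cong (toℚ x *_) (inv*toℚ-cancelˡ y (toℚ z)) ⟨
      toℚ x * (inv y * (toℚ y * toℚ z))   ≡⟨ *-assoc (toℚ x) (inv y) _ ⟨
      toℚ x * inv y * (toℚ y * toℚ z)     ≡⟨ cong (toℚ x * inv y *_) (toℚ-* y z) ⟨
      toℚ x * inv y * toℚ (y ℕ.* z)       ∎
      where open ≡-Reasoning
    scale-cb : toℚ (c ℕ.* b) ≡ toℚ c * inv d * toℚ (b ℕ.* d)
    scale-cb = trans (scale c d b) (cong (λ m → toℚ c * inv d * toℚ m) (ℕₚ.*-comm d b))

  term≡∏pred!/N! : ∀ N as → T (isComp N as) → term as ≡ toℚ (∏pred! as) * inv (N !)
  term≡∏pred!/N! N as comp with Equivalence.to T-∧ comp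
  ... | pos , sum≡N = begin
    toℚ (prodℕ (map _! as)) * inv (sumℕ as !) * inv ∏
      ≡⟨ cong₂ (λ u v → toℚ u * inv (v !) * inv ∏) (∏!≡∏*∏pred! as pos) (ℕₚ.≡ᵇ⇒≡ (sumℕ as) N sum≡N) ⟩
    toℚ (∏ ℕ.* ∏pred! as) * inv (N !) * inv ∏
      ≡⟨ cong (λ u → u * inv (N !) * inv ∏) (toℚ-* ∏ (∏pred! as)) ⟩
    toℚ ∏ * toℚ (∏pred! as) * inv (N !) * inv ∏
      ≡⟨ trans (*-comm _ (inv ∏)) (cong (inv ∏ *_) (*-assoc (toℚ ∏) _ _)) ⟩
    inv ∏ * (toℚ ∏ * (toℚ (∏pred! as) * inv (N !)))
      ≡⟨ inv*toℚ-cancelˡ ∏ {{∏-nonZero as pos}} _ ⟩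
    toℚ (∏pred! as) * inv (N !) ∎
    where
    open ≡-Reasoning
    ∏ = prodℕ as

  sumℚ-filterᵇ : ∀ {A : Set} (p : A → Bool) (f : A → ℚ) (g : A → ℕ) q →
    (∀ x → T (p x) → f x ≡ toℚ (g x) * q) → ∀ xs →
    sumℚ (map f (filterᵇ p xs)) ≡ toℚ (sumℕ (map (λ x → if p x then g x else 0) xs)) * q
  sumℚ-filterᵇ p f g q eq []       = sym (*-zeroˡ q)
  sumℚ-filterᵇ p f g q eq (x ∷ xs) with p x | eq x
  ... | false | _   = sumℚ-filterᵇ p f g q eq xs
  ... | true  | eqx = begin
    f x + sumℚ (map f (filterᵇ p xs))  ≡⟨ cong₂ _+_ (eqx _) (sumℚ-filterᵇ p f g q eq xs) ⟩
    toℚ (g x) * q + toℚ rest * q       ≡⟨ *-distribʳ-+ q (toℚ (g x)) (toℚ rest) ⟨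
    (toℚ (g x) + toℚ rest) * q         ≡⟨ cong (_* q) (toℚ-+ (g x) rest) ⟨
    toℚ (g x ℕ.+ rest) * q             ∎
    where
    open ≡-Reasoning
    rest = sumℕ (map (λ x → if p x then g x else 0) xs)

  S≡totalWeight/N! : ∀ n N → S n N ≡ toℚ (totalWeight n N) * inv (N !)
  S≡totalWeight/N! n N = begin
    sumℚ (map term (filterᵇ (isComp N) (tuples n N)))
      ≡⟨ sumℚ-filterᵇ (isComp N) term ∏pred! (inv (N !)) (term≡∏pred!/N! N) (tuples n N) ⟩
    toℚ (sumℕ (map (weight N) (tuples n N))) * inv (N !)
      ≡⟨ cong (λ t → toℚ t * inv (N !)) (sum-weight-tuples n ℕₚ.≤-refl) ⟩
    toℚ (totalWeight n N) * inv (N !) ∎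
    where open ≡-Reasoning

  ∣S∣≤ : ∀ {n N} → 2 ℕ.≤ n → n ℕ.≤ N → ∣ S n N ∣ ≤ℚ toℚ (2 ℕ.* 3 ℕ.^ n) * inv (N ℕ.* N)
  ∣S∣≤ {n} {N} 2≤n n≤N with ℕₚ.≤-trans 2≤n n≤N
  -- Exposing N = 2 + m lets instance search find NonZero (N * N).
  ... | ℕ.s≤s (ℕ.s≤s _) = begin
    ∣ S n N ∣
      ≡⟨ cong ∣_∣ (S≡totalWeight/N! n N) ⟩
    ∣ toℚ W * inv (N !) ∣
      ≡⟨ 0≤p⇒∣p∣≡p (toℚ*inv-nonNeg W (N !) {{N ℕₚ.!≢0}}) ⟩
    toℚ W * inv (N !)
      ≤⟨ toℚ*inv-mono-≤ W (N !) (2 ℕ.* 3 ℕ.^ n) (N ℕ.* N) {{N ℕₚ.!≢0}} (totalWeight*square≤ 2≤n n≤N) ⟩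
    toℚ (2 ℕ.* 3 ℕ.^ n) * inv (N ℕ.* N) ∎
    where
    open ≤-Reasoning
    W = totalWeight n N

open import Data.Nat using (ℕ; _≤_)
open import Data.Product using (∃-syntax; _,_)
open import Data.Rational using (ℚ; ∣_∣; _*_) renaming (_≤_ to _≤ℚ_)
open Rationals using (∣S∣≤)

lemma2p3 : (n : ℕ) → 2 ≤ n →
    ∃[ K ] ∃[ N₀ ] ((N : ℕ) → n ≤ N → N₀ ≤ N →
      ∣ S n N ∣ ≤ℚ K * inv (N Data.Nat.* N))
lemma2p3 n 2≤n = toℚ (2 Data.Nat.* 3 Data.Nat.^ n) , 0 , λ N n≤N _ → ∣S∣≤ 2≤n n≤N
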